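{- In each of the logics DmBL and DmBL$_\ast$, for every $\phi\in\mathcal{L}$: $\vdash(\phi\times\phi)\rightarrow(\Box\neg\phi\vee\Box\phi)$.
   Context: Fix a set $\Theta$ of atomic propositions. The language $\mathcal{L}$ is the smallest set containing $\Theta$ and closed under the formation of $\neg\phi$, $\Box\phi$, $\phi\rightarrow\psi$ and the conditional $(\psi|\phi)$. Abbreviations: $\phi\vee\psi=\neg\phi\rightarrow\psi$, $\phi\wedge\psi=\neg(\neg\phi\vee\neg\psi)$, $\phi\leftrightarrow\psi=(\phi\rightarrow\psi)\wedge(\psi\rightarrow\phi)$, $\top=\theta_0\rightarrow\theta_0$ for a fixed $\theta_0\in\Theta$, $\bot=\neg\top$, $\Diamond\phi=\neg\Box\neg\phi$, and (logical independence) $\psi\times\phi=\Box\bigl((\psi|\phi)\leftrightarrow\psi\bigr)$. The theorems ($\vdash$) of DmBL are the smallest set containing all instances of the axiom schemes below and closed under modus ponens (from $\vdash\phi$ and $\vdash\phi\rightarrow\psi$ infer $\vdash\psi$) and necessitation m1 (from $\vdash\phi$ infer $\vdash\Box\phi$): c1 $\phi\rightarrow(\psi\rightarrow\phi)$; c2 $(\eta\rightarrow(\phi\rightarrow\psi))\rightarrow((\eta\rightarrow\phi)\rightarrow(\eta\rightarrow\psi))$; c3 $(\neg\phi\rightarrow\neg\psi)\rightarrow((\neg\phi\rightarrow\psi)\rightarrow\phi)$; m2 $\Box(\phi\rightarrow\psi)\rightarrow(\Box\phi\rightarrow\Box\psi)$; m3 $\Box\phi\rightarrow\phi$; b1 $\Box(\phi\rightarrow\psi)\rightarrow(\Box\neg\phi\vee\Box(\psi|\phi))$;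 b2 $((\psi\rightarrow\eta)|\phi)\rightarrow((\psi|\phi)\rightarrow(\eta|\phi))$; b3 $(\psi|\phi)\rightarrow(\phi\rightarrow\psi)$; b4 $\neg(\neg\psi|\phi)\leftrightarrow(\psi|\phi)$; b5 $(\psi\times\phi)\leftrightarrow(\phi\times\psi)$. The logic DmBL$_\ast$ is defined in the same way but with b5 replaced by the two schemes b5.weak.A $(\psi\times\neg\phi)\leftrightarrow(\psi\times\phi)$ and b5.weak.B $\Box(\psi\leftrightarrow\eta)\rightarrow\Box((\phi|\psi)\leftrightarrow(\phi|\eta))$. -}

module Defs where

data Form (Θ : Set) : Set where
  atom  : Θ → Form Θ
  ¬'_   : Form Θ → Form Θ
  □_    : Form Θ → Form Θ
  _⇒_   : Form Θ → Form Θ → Form Θ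
  _∣_   : Form Θ → Form Θ → Form Θ

infixr 20 ¬'_ □_
infixr 10 _⇒_
infix 15 _∣_

module _ {Θ : Set} where

  _∨'_ : Form Θ → Form Θ → Form Θ
  φ ∨' ψ = (¬' φ) ⇒ ψ

  _∧'_ : Form Θ → Form Θ → Form Θ
  φ ∧' ψ = ¬' ((¬' φ) ∨' (¬' ψ))

  _⇔_ : Form Θ → Form Θ → Form Θ
  φ ⇔ ψ = (φ ⇒ ψ) ∧' (ψ ⇒ φ)

  ◇_ : Form Θ → Form Θ
  ◇ φ = ¬' (□ (¬' φ))

  _⊗_ : Form Θ → Form Θ → Form Θ
  ψ ⊗ φ = □ ((ψ ∣ φ) ⇔ ψ)

  infixr 8 _∨'_
  infixr 9 _∧'_
  infix 7 _⇔_

⊤' : {Θ : Set} → Θ → Form Θ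
⊤' θ₀ = atom θ₀ ⇒ atom θ₀

⊥' : {Θ : Set} → Θ → Form Θ
⊥' θ₀ = ¬' (⊤' θ₀)

data Logic : Set where
  DmBL DmBL* : Logic

data ⊢[_]_ {Θ : Set} : Logic → Form Θ → Set where
  c1  : ∀ {L} φ ψ → ⊢[ L ] (φ ⇒ (ψ ⇒ φ))
  c2  : ∀ {L} η φ ψ → ⊢[ L ] ((η ⇒ (φ ⇒ ψ)) ⇒ ((η ⇒ φ) ⇒ (η ⇒ ψ)))
  c3  : ∀ {L} φ ψ → ⊢[ L ] (((¬' φ) ⇒ (¬' ψ)) ⇒ (((¬' φ) ⇒ ψ) ⇒ φ))
  m2  : ∀ {L} φ ψ → ⊢[ L ] ((□ (φ ⇒ ψ)) ⇒ ((□ φ) ⇒ (□ ψ)))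
  m3  : ∀ {L} φ → ⊢[ L ] ((□ φ) ⇒ φ)
  b1  : ∀ {L} φ ψ → ⊢[ L ] ((□ (φ ⇒ ψ)) ⇒ ((□ (¬' φ)) ∨' (□ (ψ ∣ φ))))
  b2  : ∀ {L} φ ψ η → ⊢[ L ] (((ψ ⇒ η) ∣ φ) ⇒ ((ψ ∣ φ) ⇒ (η ∣ φ)))
  b3  : ∀ {L} φ ψ → ⊢[ L ] ((ψ ∣ φ) ⇒ (φ ⇒ ψ))
  b4  : ∀ {L} φ ψ → ⊢[ L ] ((¬' ((¬' ψ) ∣ φ)) ⇔ (ψ ∣ φ))
  b5  : ∀ φ ψ → ⊢[ DmBL ] ((ψ ⊗ φ) ⇔ (φ ⊗ ψ))
  b5wA : ∀ φ ψ → ⊢[ DmBL* ] ((ψ ⊗ (¬' φ)) ⇔ (ψ ⊗ φ))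
  b5wB : ∀ φ ψ η → ⊢[ DmBL* ] ((□ (ψ ⇔ η)) ⇒ (□ ((φ ∣ ψ) ⇔ (φ ∣ η))))
  mp  : ∀ {L φ ψ} → ⊢[ L ] φ → ⊢[ L ] (φ ⇒ ψ) → ⊢[ L ] ψ
  nec : ∀ {L φ} → ⊢[ L ] φ → ⊢[ L ] (□ φ)

infix 5 ⊢[_]_

{-# OPTIONS --safe #-}
module Submission where

-- Assume φ × φ, i.e. □((φ|φ) ↔ φ), and ◇φ.  Axiom b1 applied to □(φ → φ) gives
-- □¬φ ∨ □(φ|φ), so ◇φ yields □(φ|φ); and □((φ|φ) → φ), extracted from φ × φ,
-- turns □(φ|φ) into □φ.

open import Data.List using (List; []; _∷_)
open import Data.List.Membership.Propositional using (_∈_)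
open import Data.List.Relation.Unary.Any using (here; there)
open import Relation.Binary.PropositionalEquality using (refl)

open import Defs

data _⊩[_]_ {Θ : Set} (Γ : List (Form Θ)) (L : Logic) : Form Θ → Set where
  axiom       : ∀ {φ} → ⊢[ L ] φ → Γ ⊩[ L ] φ
  assumption  : ∀ {φ} → φ ∈ Γ → Γ ⊩[ L ] φ
  modusPonens : ∀ {φ ψ} → Γ ⊩[ L ] φ → Γ ⊩[ L ] (φ ⇒ ψ) → Γ ⊩[ L ] ψ

infix 5 _⊩[_]_

module _ {Θ : Set} {L : Logic} where

  ⇒-refl : (φ : Form Θ) → ⊢[ L ] (φ ⇒ φ)
  ⇒-refl φ = mp (c1 φ φ) (mp (c1 φ (φ ⇒ φ)) (c2 φ (φ ⇒ φ) φ))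

  deduction : ∀ {Γ : List (Form Θ)} {φ ψ} → (φ ∷ Γ) ⊩[ L ] ψ → Γ ⊩[ L ] (φ ⇒ ψ)
  deduction {φ = φ} {ψ} (axiom ⊢ψ)               = axiom (mp ⊢ψ (c1 ψ φ))
  deduction {φ = φ}     (assumption (here refl))  = axiom (⇒-refl φ)
  deduction {φ = φ} {ψ} (assumption (there ψ∈Γ)) = modusPonens (assumption ψ∈Γ) (axiom (c1 ψ φ))
  deduction {φ = φ} {ψ} (modusPonens {χ} dχ dχ⇒ψ) =
    modusPonens (deduction dχ) (modusPonens (deduction dχ⇒ψ) (axiom (c2 φ χ ψ)))

  closed : {φ : Form Θ} → [] ⊩[ L ] φ → ⊢[ L ] φ
  closed (axiom ⊢φ)            = ⊢φ
  closed (modusPonens dφ dφ⇒ψ) = mp (closed dφ) (closed dφ⇒ψ)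

  explosion : (φ ψ : Form Θ) → ⊢[ L ] ((¬' φ) ⇒ (φ ⇒ ψ))
  explosion φ ψ = closed (deduction (deduction
    (modusPonens (deduction (assumption (there (here refl))))
      (modusPonens (deduction (assumption (there (there (here refl)))))
        (axiom (c3 ψ φ))))))

  ∧-elimˡ : (φ ψ : Form Θ) → ⊢[ L ] ((φ ∧' ψ) ⇒ φ)
  ∧-elimˡ φ ψ = closed (deduction
    (modusPonens
      (deduction (deduction
        (modusPonens (assumption (there (here refl)))
          (modusPonens (assumption (here refl)) (axiom (explosion (¬' φ) (¬' ψ)))))))
      (modusPonens (deduction (assumption (there (here refl))))
        (axiom (c3 φ ((¬' (¬' φ)) ⇒ (¬' ψ)))))))

  □-mono : ∀ {φ ψ : Form Θ} → ⊢[ L ] (φ ⇒ ψ) → ⊢[ L ] ((□ φ) ⇒ (□ ψ))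
  □-mono {φ} {ψ} ⊢φ⇒ψ = mp (nec ⊢φ⇒ψ) (m2 φ ψ)

  ◇⇒□-self-conditional : (φ : Form Θ) → ⊢[ L ] ((◇ φ) ⇒ (□ (φ ∣ φ)))
  ◇⇒□-self-conditional φ = mp (nec (⇒-refl φ)) (b1 φ φ)

  ⊗-self⇒□-conditional⇒□ : (φ : Form Θ) → ⊢[ L ] ((φ ⊗ φ) ⇒ (□ ((φ ∣ φ) ⇒ φ)))
  ⊗-self⇒□-conditional⇒□ φ = □-mono (∧-elimˡ ((φ ∣ φ) ⇒ φ) (φ ⇒ (φ ∣ φ)))

mainTheorem8 : {Θ : Set} → Θ → (L : Logic) → (φ : Form Θ)
    → ⊢[ L ] ((φ ⊗ φ) ⇒ ((□ (¬' φ)) ∨' (□ φ)))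
-- □¬φ ∨ □φ is, by the definition of ∨', literally ◇φ ⇒ □φ.
mainTheorem8 _ L φ = closed (deduction (deduction (modusPonens □φ∣φ □φ∣φ⇒□φ)))
  where
  □φ∣φ : (◇ φ ∷ φ ⊗ φ ∷ []) ⊩[ L ] (□ (φ ∣ φ))
  □φ∣φ = modusPonens (assumption (here refl)) (axiom (◇⇒□-self-conditional φ))

  □φ∣φ⇒□φ : (◇ φ ∷ φ ⊗ φ ∷ []) ⊩[ L ] ((□ (φ ∣ φ)) ⇒ (□ φ))
  □φ∣φ⇒□φ = modusPonens
    (modusPonens (assumption (there (here refl))) (axiom (⊗-self⇒□-conditional⇒□ φ)))
    (axiom (m2 (φ ∣ φ) φ))
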